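{- The system $(\mathbf{EMN})^\Delta$ (axiomatized by TAUT, $\Delta$Equ, $\Delta$M, $\Delta$N and the rules modus ponens and RE$\Delta$) is sound and strongly complete with respect to the class of all neighborhood frames satisfying $(s)$ and $(n)$.
   Context: The language $\mathcal{L}(\Delta)$ is given by $\phi::=p\mid\neg\phi\mid\phi\land\phi\mid\Delta\phi$ with $p$ ranging over a fixed countably infinite set $\mathbf{P}$ of propositional variables; $\vee$ and $\top$ are the usual abbreviations. A neighborhood model is $\mathcal{M}=\langle S,N,V\rangle$ with $S\neq\emptyset$, $N:S\to\mathcal{P}(\mathcal{P}(S))$, $V:\mathbf{P}\to\mathcal{P}(S)$. Truth: $\mathcal{M},s\vDash p$ iff $s\in V(p)$; Boolean clauses as usual; $\mathcal{M},s\vDash\Delta\phi$ iff $\phi^{\mathcal{M}}\in N(s)$ or $S\setminus\phi^{\mathcal{M}}\in N(s)$, with $\phi^{\mathcal{M}}$ the truth set of $\phi$. Frame properties, required for every $s\in S$: $(n)$ $S\in N(s)$; $(s)$ $X\in N(s)$ and $X\subseteq Y\subseteq S$ imply $Y\in N(s)$. Axioms/rules: TAUT, $\Delta$Equ: $\Delta\phi\leftrightarrow\Delta\neg\phi$; $\Delta$M: $\Delta\phi\to\Delta(\phi\vee\psi)\vee\Delta(\neg\phi\vee\chi)$; $\Delta$N: $\Delta\top$; RE$\Delta$: from $\phi\leftrightarrow\psi$ infer $\Delta\phi\leftrightarrow\Delta\psi$; plus modus ponens. Soundness: every theorem is valid on every frame of the class. Strong completeness: for every set $\Gamma$ and formula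 $\phi$, if $\phi$ holds at every state of every model on a frame in the class where all of $\Gamma$ holds, then $\phi$ is derivable from $\Gamma$. -}

module Defs where

open import Data.Nat using (ℕ)
open import Data.Bool using (Bool; true; false; not; _∧_)
open import Data.List using (List; []; _∷_)
open import Data.List.Relation.Unary.All using (All)
open import Data.Product using (Σ; _×_)
open import Relation.Binary.PropositionalEquality using (_≡_)
open import Relation.Nullary using (Dec)

infixr 6 _∧'_
data Form : Set where
  var  : ℕ → Form
  ¬'_  : Form → Form
  _∧'_ : Form → Form → Form
  Δ    : Form → Form

_∨'_ : Form → Form → Form
φ ∨' ψ = ¬' ((¬' φ) ∧' (¬' ψ))

_→'_ : Form → Form → Form
φ →' ψ = ¬' (φ ∧' (¬' ψ))

_↔'_ : Form → Form → Form
φ ↔' ψ = (φ →' ψ) ∧' (ψ →' φ)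

⊤' : Form
⊤' = ¬' (var 0 ∧' (¬' (var 0)))

tv : (ℕ → Bool) → (Form → Bool) → Form → Bool
tv v w (var p)  = v p
tv v w (¬' φ)   = not (tv v w φ)
tv v w (φ ∧' ψ) = tv v w φ ∧ tv v w ψ
tv v w (Δ φ)    = w φ

Tautology : Form → Set
Tautology φ = (v : ℕ → Bool) (w : Form → Bool) → tv v w φ ≡ true

data Thm : Form → Set where
  taut : ∀ {φ} → Tautology φ → Thm φ
  ΔEqu : ∀ φ → Thm (Δ φ ↔' Δ (¬' φ))
  ΔM   : ∀ φ ψ χ → Thm (Δ φ →' (Δ (φ ∨' ψ) ∨' Δ ((¬' φ) ∨' χ)))
  ΔN   : Thm (Δ ⊤')
  mp   : ∀ {φ ψ} → Thm (φ →' ψ) → Thm φ → Thm ψ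
  REΔ  : ∀ {φ ψ} → Thm (φ ↔' ψ) → Thm (Δ φ ↔' Δ ψ)

conj : List Form → Form
conj []       = ⊤'
conj (γ ∷ γs) = γ ∧' conj γs

_⊢_ : (Form → Set) → Form → Set
Γ ⊢ φ = Σ (List Form) (λ γs → All Γ γs × Thm (conj γs →' φ))

-- Neighborhood semantics. Subsets of S are Bool-valued predicates
-- (classical reading of P(S)); N(s) is a Bool-valued predicate on them.

record Frame : Set₁ where
  field
    S : Set
    N : S → (S → Bool) → Bool

record Model : Set₁ where
  field
    frame : Frame
  open Frame frame public
  field
    V : ℕ → S → Bool

module _ (M : Model) where
  open Model M

  sat : Form → S → Bool
  sat (var p)  s = V p s
  sat (¬' φ)   s = not (sat φ s)
  sat (φ ∧' ψ) s = sat φ s ∧ sat ψ s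
  sat (Δ φ)    s = N s (λ t → sat φ t) Data.Bool.∨ N s (λ t → not (sat φ t))

_,_⊨_ : (M : Model) → Model.S M → Form → Set
M , s ⊨ φ = sat M φ s ≡ true

_⊆_ : {S : Set} → (S → Bool) → (S → Bool) → Set
X ⊆ Y = ∀ x → X x ≡ true → Y x ≡ true

HasN : Frame → Set
HasN F = ∀ s → N s (λ _ → true) ≡ true
  where open Frame F

HasS : Frame → Set
HasS F = ∀ s (X Y : S → Bool) → N s X ≡ true → X ⊆ Y → N s Y ≡ true
  where open Frame F

InClass : Frame → Set
InClass F = HasN F × HasS F

Valid : Form → Set₁
Valid φ = (M : Model) → InClass (Model.frame M) → ∀ s → M , s ⊨ φ

_⊨C_ : (Form → Set) → Form → Set₁
Γ ⊨C φ = (M : Model) → InClass (Model.frame M) → ∀ s →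
         (∀ γ → Γ γ → M , s ⊨ γ) → M , s ⊨ φ

Sound : Set₁
Sound = ∀ φ → Thm φ → Valid φ

StronglyComplete : Set₁
StronglyComplete = (Γ : Form → Set) (φ : Form) → Γ ⊨C φ → Γ ⊢ φ

-- Excluded middle (the classical metatheory of the paper)
ExcludedMiddle : Set₁
ExcludedMiddle = (A : Set) → Dec A

module Submission where

-- Soundness is checked axiom by axiom; under (s) the neighbourhood function
-- respects extensional equality of sets, which validates REΔ and ΔEqu.
-- For completeness take the canonical model on maximal consistent sets
-- (Lindenbaum's lemma: enumerate the formulas and decide consistency
-- classically), where X ∈ N(s) iff X includes the truth set of some φ all
-- of whose provable consequences ψ have Δψ ∈ s. Then (s) is immediate and
-- (n) follows from ΔN. In the truth lemma, Δψ ∈ s makes ψ or ¬ψ such a φ: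
-- if ψ → χ and ¬ψ → χ′ are provable with Δχ, Δχ′ ∉ s, then ΔM and REΔ put
-- Δχ or Δχ′ into s.

open import Defs hiding (_⊆_)
open import Data.Bool using (Bool; true; false; not; _∧_; _∨_)
open import Data.Bool.Properties using (∧-conicalˡ; ∧-conicalʳ; ∨-comm; not-involutive; ⇔→≡)
open import Data.Empty using (⊥; ⊥-elim)
open import Data.List using (List; []; _∷_; _++_)
open import Data.List.Properties using (∷-injectiveʳ; ++-assoc; ++-identityʳ)
open import Data.List.Relation.Unary.All as All using (All; []; _∷_)
open import Data.List.Relation.Unary.All.Properties using (++⁺)
open import Data.Nat using (ℕ; zero; suc; _⊔_; _≤′_; ≤′-reflexive; ≤′-step)
open import Data.Nat.Properties using (m≤m⊔n; m≤n⊔m; ≤⇒≤′)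
open import Data.Nat.Binary as ℕᵇ using (ℕᵇ; 2[1+_]; 1+[2_])
open import Data.Nat.Binary.Properties using (toℕ-injective)
open import Data.Product using (Σ; ∃; _×_; _,_; proj₁)
open import Data.Sum using (_⊎_; inj₁; inj₂)
open import Function.Base using (_∘_; case_of_)
open import Function.Bundles using (mk⇔)
open import Relation.Binary.PropositionalEquality using (_≡_; refl; sym; trans; cong; cong₂; subst)
open import Relation.Nullary using (¬_; Dec; yes; no; does)
open import Relation.Nullary.Decidable using (dec-true)
open import Relation.Unary using (∅; ｛_｝; _∪_; _⊆_)

IsTrue : Bool → Set
IsTrue b = b ≡ true

_⇒ᵇ_ : Bool → Bool → Bool
a ⇒ᵇ b = not (a ∧ not b)

_⇔ᵇ_ : Bool → Bool → Bool
a ⇔ᵇ b = (a ⇒ᵇ b) ∧ (b ⇒ᵇ a)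

_∨ᵇ_ : Bool → Bool → Bool
a ∨ᵇ b = not (not a ∧ not b)

IsTrue-stable : ∀ b → ¬ ¬ IsTrue b → IsTrue b
IsTrue-stable true  _   = refl
IsTrue-stable false ¬¬b = ⊥-elim (¬¬b λ ())

∧-intro : ∀ {a b} → IsTrue a → IsTrue b → IsTrue (a ∧ b)
∧-intro refl refl = refl

not-intro : ∀ a → ¬ IsTrue a → IsTrue (not a)
not-intro true  ¬a = ⊥-elim (¬a refl)
not-intro false _  = refl

not-elim : ∀ a → IsTrue (not a) → ¬ IsTrue a
not-elim true () _

⇒ᵇ-intro : ∀ a b → (IsTrue a → IsTrue b) → IsTrue (a ⇒ᵇ b)
⇒ᵇ-intro true  b a⇒b rewrite a⇒b refl = refl
⇒ᵇ-intro false b _   = refl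

⇒ᵇ-elim : ∀ a b → IsTrue (a ⇒ᵇ b) → IsTrue a → IsTrue b
⇒ᵇ-elim true true _ _ = refl

⇔ᵇ-intro : ∀ {a b} → a ≡ b → IsTrue (a ⇔ᵇ b)
⇔ᵇ-intro {true}  refl = refl
⇔ᵇ-intro {false} refl = refl

⇔ᵇ-elim : ∀ a b → IsTrue (a ⇔ᵇ b) → a ≡ b
⇔ᵇ-elim true  true  _ = refl
⇔ᵇ-elim false false _ = refl

∨-introˡ : ∀ {a} b → IsTrue a → IsTrue (a ∨ b)
∨-introˡ b refl = refl

∨-introʳ : ∀ a {b} → IsTrue b → IsTrue (a ∨ b)
∨-introʳ true  _ = refl
∨-introʳ false b = b

∨-elim : ∀ a b → IsTrue (a ∨ b) → IsTrue a ⊎ IsTrue b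
∨-elim true  _ _ = inj₁ refl
∨-elim false _ b = inj₂ b

∨ᵇ-introˡ : ∀ {a} b → IsTrue a → IsTrue (a ∨ᵇ b)
∨ᵇ-introˡ b refl = refl

∨ᵇ-introʳ : ∀ a {b} → IsTrue b → IsTrue (a ∨ᵇ b)
∨ᵇ-introʳ true  _    = refl
∨ᵇ-introʳ false refl = refl

∨ᵇ-elim : ∀ a b → IsTrue (a ∨ᵇ b) → IsTrue a ⊎ IsTrue b
∨ᵇ-elim true  _    _ = inj₁ refl
∨ᵇ-elim false true _ = inj₂ refl

does⇒ : ∀ {A : Set} (a? : Dec A) → IsTrue (does a?) → A
does⇒ (yes a) _ = a

Theory : Set₁
Theory = Form → Set

⊥' : Form
⊥' = ¬' ⊤'

Consistent : Theory → Set
Consistent Γ = ¬ (Γ ⊢ ⊥')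

infix 2 _⊨ₜ_ _&_⊨ₜ_

_⊨ₜ_ : Form → Form → Set
φ ⊨ₜ ψ = ∀ v w → IsTrue (tv v w φ) → IsTrue (tv v w ψ)

_&_⊨ₜ_ : Form → Form → Form → Set
φ & ψ ⊨ₜ χ = ∀ v w → IsTrue (tv v w φ) → IsTrue (tv v w ψ) → IsTrue (tv v w χ)

⊤'-true : ∀ v w → IsTrue (tv v w ⊤')
⊤'-true v w = ⇒ᵇ-intro (v 0) (v 0) λ p → p

mp-taut : ∀ {φ ψ} → (φ →' ψ) & φ ⊨ₜ ψ
mp-taut v w = ⇒ᵇ-elim _ _

explosion-taut : ∀ {φ ψ} → φ & ¬' φ ⊨ₜ ψ
explosion-taut v w p ¬p = ⊥-elim (not-elim _ ¬p p)

Thm-taut₂ : ∀ {φ ψ χ} → Thm φ → Thm ψ → φ & ψ ⊨ₜ χ → Thm χ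
Thm-taut₂ {φ} {ψ} {χ} ⊢φ ⊢ψ φψ⊨χ = mp (mp (taut tautology) ⊢φ) ⊢ψ
  where
    tautology : Tautology (φ →' (ψ →' χ))
    tautology v w = ⇒ᵇ-intro _ _ λ p → ⇒ᵇ-intro _ _ (φψ⊨χ v w p)

Thm-taut : ∀ {φ ψ} → Thm φ → φ ⊨ₜ ψ → Thm ψ
Thm-taut ⊢φ φ⊨ψ = Thm-taut₂ ⊢φ ⊢φ λ v w p _ → φ⊨ψ v w p

conj-++ : ∀ γs δs v w → IsTrue (tv v w (conj (γs ++ δs))) →
          IsTrue (tv v w (conj γs)) × IsTrue (tv v w (conj δs))
conj-++ []       δs v w t = ⊤'-true v w , t
conj-++ (γ ∷ γs) δs v w t =
  let (tγs , tδs) = conj-++ γs δs v w (∧-conicalʳ _ _ t)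
  in ∧-intro (∧-conicalˡ _ _ t) tγs , tδs

module _ {Γ : Theory} where

  ⊢-thm : ∀ {φ} → Thm φ → Γ ⊢ φ
  ⊢-thm ⊢φ = [] , [] , Thm-taut ⊢φ λ v w p → ⇒ᵇ-intro _ _ λ _ → p

  ⊢-∈ : ∀ {φ} → Γ φ → Γ ⊢ φ
  ⊢-∈ {φ} γ = (φ ∷ []) , (γ ∷ []) , taut λ v w → ⇒ᵇ-intro _ _ (∧-conicalˡ (tv v w φ) _)

  ⊢-taut₂ : ∀ {φ ψ χ} → Γ ⊢ φ → Γ ⊢ ψ → φ & ψ ⊨ₜ χ → Γ ⊢ χ
  ⊢-taut₂ (γs , γs∈Γ , ⊢γs→φ) (δs , δs∈Γ , ⊢δs→ψ) φψ⊨χ =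
    (γs ++ δs) , ++⁺ γs∈Γ δs∈Γ , Thm-taut₂ ⊢γs→φ ⊢δs→ψ λ v w γs→φ δs→ψ →
      ⇒ᵇ-intro _ _ λ t → let (tγs , tδs) = conj-++ γs δs v w t in
        φψ⊨χ v w (⇒ᵇ-elim _ _ γs→φ tγs) (⇒ᵇ-elim _ _ δs→ψ tδs)

  ⊢-taut : ∀ {φ ψ} → Γ ⊢ φ → φ ⊨ₜ ψ → Γ ⊢ ψ
  ⊢-taut ⊢φ φ⊨ψ = ⊢-taut₂ ⊢φ ⊢φ λ v w p _ → φ⊨ψ v w p

⊢-mono : ∀ {Γ Θ φ} → Γ ⊆ Θ → Γ ⊢ φ → Θ ⊢ φ
⊢-mono Γ⊆Θ (γs , γs∈Γ , ⊢γs→φ) = γs , All.map Γ⊆Θ γs∈Γ , ⊢γs→φ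

⊢-∅ : ∀ {φ} → ∅ ⊢ φ → Thm φ
⊢-∅ ([] , [] , ⊢⊤→φ) = mp ⊢⊤→φ (taut ⊤'-true)

deduction : ∀ {Γ ψ χ} → (Γ ∪ ｛ ψ ｝) ⊢ χ → Γ ⊢ (ψ →' χ)
deduction {Γ} {ψ} (γs , γs∈Γψ , ⊢γs→χ) =
  let (δs , δs∈Γ , δsψ⊨γs) = discharge γs γs∈Γψ
  in δs , δs∈Γ , Thm-taut ⊢γs→χ λ v w γs→χ →
       ⇒ᵇ-intro _ _ λ tδs → ⇒ᵇ-intro _ _ λ tψ → ⇒ᵇ-elim _ _ γs→χ (δsψ⊨γs v w tδs tψ)
  where
    discharge : ∀ γs → All (Γ ∪ ｛ ψ ｝) γs →
                Σ (List Form) λ δs → All Γ δs × (conj δs & ψ ⊨ₜ conj γs)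
    discharge []       []                = [] , [] , λ v w _ _ → ⊤'-true v w
    discharge (γ ∷ γs) (inj₁ γ∈Γ  ∷ rest) =
      let (δs , δs∈Γ , h) = discharge γs rest
      in (γ ∷ δs) , (γ∈Γ ∷ δs∈Γ) , λ v w t tψ →
           ∧-intro (∧-conicalˡ _ _ t) (h v w (∧-conicalʳ _ _ t) tψ)
    discharge (γ ∷ γs) (inj₂ refl ∷ rest) =
      let (δs , δs∈Γ , h) = discharge γs rest
      in δs , δs∈Γ , λ v w t tψ → ∧-intro tψ (h v w t tψ)

consistent-∪-¬ : ∀ {Γ φ} → ¬ (Γ ⊢ φ) → Consistent (Γ ∪ ｛ ¬' φ ｝)
consistent-∪-¬ Γ⊬φ Γ¬φ⊢⊥ = Γ⊬φ (⊢-taut (deduction Γ¬φ⊢⊥) λ v w ¬φ→⊥ →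
  IsTrue-stable _ λ ¬φ → not-elim _ (⇒ᵇ-elim _ _ ¬φ→⊥ (not-intro _ ¬φ)) (⊤'-true v w))

unary : ℕ → List Bool
unary zero    = false ∷ []
unary (suc n) = true ∷ unary n

encode : Form → List Bool
encode (var n)  = false ∷ false ∷ unary n
encode (¬' φ)   = false ∷ true ∷ encode φ
encode (φ ∧' ψ) = true ∷ false ∷ (encode φ ++ encode ψ)
encode (Δ φ)    = true ∷ true ∷ encode φ

unary-++-injective : ∀ m n {r r′} → unary m ++ r ≡ unary n ++ r′ → m ≡ n × r ≡ r′
unary-++-injective zero    zero    eq = refl , ∷-injectiveʳ eq
unary-++-injective (suc m) (suc n) eq =
  let (m≡n , r≡r′) = unary-++-injective m n (∷-injectiveʳ eq) in cong suc m≡n , r≡r′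

-- Injectivity up to arbitrary suffixes, since the code is prefix-free.
encode-++-injective : ∀ φ ψ {r r′} → encode φ ++ r ≡ encode ψ ++ r′ → φ ≡ ψ × r ≡ r′
encode-++-injective (var m) (var n) eq =
  let (m≡n , r≡r′) = unary-++-injective m n (∷-injectiveʳ (∷-injectiveʳ eq))
  in cong var m≡n , r≡r′
encode-++-injective (¬' φ) (¬' ψ) eq =
  let (φ≡ψ , r≡r′) = encode-++-injective φ ψ (∷-injectiveʳ (∷-injectiveʳ eq))
  in cong ¬'_ φ≡ψ , r≡r′
encode-++-injective (φ₁ ∧' φ₂) (ψ₁ ∧' ψ₂) {r} {r′} eq =
  let (φ₁≡ψ₁ , rest) = encode-++-injective φ₁ ψ₁
        (trans (sym (++-assoc (encode φ₁) (encode φ₂) r))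
          (trans (∷-injectiveʳ (∷-injectiveʳ eq)) (++-assoc (encode ψ₁) (encode ψ₂) r′)))
      (φ₂≡ψ₂ , r≡r′) = encode-++-injective φ₂ ψ₂ rest
  in cong₂ _∧'_ φ₁≡ψ₁ φ₂≡ψ₂ , r≡r′
encode-++-injective (Δ φ) (Δ ψ) eq =
  let (φ≡ψ , r≡r′) = encode-++-injective φ ψ (∷-injectiveʳ (∷-injectiveʳ eq))
  in cong Δ φ≡ψ , r≡r′
encode-++-injective (var _)  (¬' _)   ()
encode-++-injective (var _)  (_ ∧' _) ()
encode-++-injective (var _)  (Δ _)    ()
encode-++-injective (¬' _)   (var _)  ()
encode-++-injective (¬' _)   (_ ∧' _) ()
encode-++-injective (¬' _)   (Δ _)    ()
encode-++-injective (_ ∧' _) (var _)  ()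
encode-++-injective (_ ∧' _) (¬' _)   ()
encode-++-injective (_ ∧' _) (Δ _)    ()
encode-++-injective (Δ _)    (var _)  ()
encode-++-injective (Δ _)    (¬' _)   ()
encode-++-injective (Δ _)    (_ ∧' _) ()

-- Bijective base-2 numerals are exactly bit lists.
bits→ℕᵇ : List Bool → ℕᵇ
bits→ℕᵇ []           = ℕᵇ.zero
bits→ℕᵇ (true ∷ bs)  = 2[1+ bits→ℕᵇ bs ]
bits→ℕᵇ (false ∷ bs) = 1+[2 bits→ℕᵇ bs ]

bits→ℕᵇ-injective : ∀ bs cs → bits→ℕᵇ bs ≡ bits→ℕᵇ cs → bs ≡ cs
bits→ℕᵇ-injective []           []           _  = refl
bits→ℕᵇ-injective (true ∷ bs)  (true ∷ cs)  eq = cong (true ∷_) (bits→ℕᵇ-injective bs cs (2[1+]-injective eq))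
  where 2[1+]-injective : ∀ {x y} → 2[1+ x ] ≡ 2[1+ y ] → x ≡ y
        2[1+]-injective refl = refl
bits→ℕᵇ-injective (false ∷ bs) (false ∷ cs) eq = cong (false ∷_) (bits→ℕᵇ-injective bs cs (1+[2]-injective eq))
  where 1+[2]-injective : ∀ {x y} → 1+[2 x ] ≡ 1+[2 y ] → x ≡ y
        1+[2]-injective refl = refl
bits→ℕᵇ-injective []           (true ∷ _)   ()
bits→ℕᵇ-injective []           (false ∷ _)  ()
bits→ℕᵇ-injective (true ∷ _)   []           ()
bits→ℕᵇ-injective (false ∷ _)  []           ()
bits→ℕᵇ-injective (true ∷ _)   (false ∷ _)  ()
bits→ℕᵇ-injective (false ∷ _)  (true ∷ _)   ()

code : Form → ℕ
code φ = ℕᵇ.toℕ (bits→ℕᵇ (encode φ))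

code-injective : ∀ {φ ψ} → code φ ≡ code ψ → φ ≡ ψ
code-injective {φ} {ψ} eq = proj₁ (encode-++-injective φ ψ {[]} {[]}
  (trans (++-identityʳ (encode φ))
    (trans (bits→ℕᵇ-injective _ _ (toℕ-injective eq)) (sym (++-identityʳ (encode ψ))))))

-- Membership is Bool-valued so that these sets form a small type, as the
-- states of a frame must.
record MCS : Set where
  field
    holds      : Form → Bool
    consistent : Consistent (λ φ → IsTrue (holds φ))
    maximal    : ∀ φ → IsTrue (holds φ) ⊎ IsTrue (holds (¬' φ))

open MCS

infix 4 _∈_ _∉_

_∈_ : Form → MCS → Set
φ ∈ s = IsTrue (holds s φ)

_∉_ : Form → MCS → Set
φ ∉ s = ¬ (φ ∈ s)

module _ (s : MCS) where

  ¬-∈ : ∀ {φ} → (¬' φ) ∈ s → φ ∉ s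
  ¬-∈ {φ} ¬φ∈s φ∈s =
    consistent s (⊢-taut₂ (⊢-∈ {φ = φ} φ∈s) (⊢-∈ {φ = ¬' φ} ¬φ∈s) (explosion-taut {φ} {⊥'}))

  ∈-closed : ∀ {φ} → (_∈ s) ⊢ φ → φ ∈ s
  ∈-closed {φ} s⊢φ with maximal s φ
  ... | inj₁ φ∈s  = φ∈s
  ... | inj₂ ¬φ∈s = ⊥-elim (consistent s (⊢-taut₂ s⊢φ (⊢-∈ {φ = ¬' φ} ¬φ∈s) (explosion-taut {φ} {⊥'})))

  ∈-taut₂ : ∀ {φ ψ χ} → φ ∈ s → ψ ∈ s → φ & ψ ⊨ₜ χ → χ ∈ s
  ∈-taut₂ {φ} {ψ} φ∈s ψ∈s φψ⊨χ = ∈-closed (⊢-taut₂ (⊢-∈ {φ = φ} φ∈s) (⊢-∈ {φ = ψ} ψ∈s) φψ⊨χ)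

  Thm⇒∈ : ∀ {φ} → Thm φ → φ ∈ s
  Thm⇒∈ ⊢φ = ∈-closed (⊢-thm ⊢φ)

  Thm-mp : ∀ {φ ψ} → Thm (φ →' ψ) → φ ∈ s → ψ ∈ s
  Thm-mp {φ} {ψ} ⊢φ→ψ φ∈s = ∈-taut₂ (Thm⇒∈ ⊢φ→ψ) φ∈s (mp-taut {φ} {ψ})

  ∉-¬ : ∀ {φ} → φ ∉ s → (¬' φ) ∈ s
  ∉-¬ {φ} φ∉s with maximal s φ
  ... | inj₁ φ∈s  = ⊥-elim (φ∉s φ∈s)
  ... | inj₂ ¬φ∈s = ¬φ∈s

  ∨'-∈ : ∀ {φ ψ} → (φ ∨' ψ) ∈ s → φ ∈ s ⊎ ψ ∈ s
  ∨'-∈ {φ} {ψ} φ∨ψ∈s with maximal s φ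
  ... | inj₁ φ∈s  = inj₁ φ∈s
  ... | inj₂ ¬φ∈s = inj₂ (∈-taut₂ φ∨ψ∈s ¬φ∈s disjunctive-syllogism)
    where
      disjunctive-syllogism : (φ ∨' ψ) & ¬' φ ⊨ₜ ψ
      disjunctive-syllogism v w φ∨ψ ¬φ with ∨ᵇ-elim _ _ φ∨ψ
      ... | inj₁ φ′ = ⊥-elim (not-elim _ ¬φ φ′)
      ... | inj₂ ψ′ = ψ′

module Lindenbaum (em : ExcludedMiddle) {Γ : Theory} (Γ-consistent : Consistent Γ) where

  stage : ℕ → Theory
  stage zero    = Γ
  stage (suc n) = stage n ∪ λ ψ → code ψ ≡ n × Consistent (stage n ∪ ｛ ψ ｝)

  stage-consistent : ∀ n → Consistent (stage n)
  stage-consistent zero = Γ-consistent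
  stage-consistent (suc n) with em (∃ λ ψ → code ψ ≡ n × Consistent (stage n ∪ ｛ ψ ｝))
  ... | yes (ψ , code-ψ , consistent-ψ) = consistent-ψ ∘ ⊢-mono stage⊆
    where
      stage⊆ : stage (suc n) ⊆ stage n ∪ ｛ ψ ｝
      stage⊆ (inj₁ χ∈)            = inj₁ χ∈
      stage⊆ (inj₂ (code-χ , _)) = inj₂ (code-injective (trans code-ψ (sym code-χ)))
  ... | no none = stage-consistent n ∘ ⊢-mono stage⊆
    where
      stage⊆ : stage (suc n) ⊆ stage n
      stage⊆ (inj₁ χ∈)                     = χ∈
      stage⊆ {χ} (inj₂ (code-χ , consistent-χ)) = ⊥-elim (none (χ , code-χ , consistent-χ))

  stage-mono : ∀ {m n} → m ≤′ n → stage m ⊆ stage n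
  stage-mono (≤′-reflexive refl) χ∈ = χ∈
  stage-mono (≤′-step m≤n)       χ∈ = inj₁ (stage-mono m≤n χ∈)

  limit : Theory
  limit ψ = ∃ λ n → stage n ψ

  finite-in-stage : ∀ {γs} → All limit γs → ∃ λ n → All (stage n) γs
  finite-in-stage []                 = 0 , []
  finite-in-stage ((m , γ∈) ∷ γs∈) =
    let (n , γs∈stage) = finite-in-stage γs∈
    in m ⊔ n , stage-mono (≤⇒≤′ (m≤m⊔n m n)) γ∈ ∷ All.map (stage-mono (≤⇒≤′ (m≤n⊔m m n))) γs∈stage

  limit-consistent : Consistent limit
  limit-consistent (γs , γs∈ , ⊢γs→⊥) =
    let (n , γs∈stage) = finite-in-stage γs∈ in stage-consistent n (γs , γs∈stage , ⊢γs→⊥)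

  ∉limit-refutable : ∀ ψ → ¬ limit ψ → limit ⊢ (ψ →' ⊥')
  ∉limit-refutable ψ ψ∉ with em ((stage (code ψ) ∪ ｛ ψ ｝) ⊢ ⊥')
  ... | yes ⊢⊥ = ⊢-mono (code ψ ,_) (deduction ⊢⊥)
  ... | no  ⊬⊥ = ⊥-elim (ψ∉ (suc (code ψ) , inj₂ (refl , ⊬⊥)))

  limit-maximal : ∀ ψ → limit ψ ⊎ limit (¬' ψ)
  limit-maximal ψ with em (limit ψ) | em (limit (¬' ψ))
  ... | yes ψ∈ | _       = inj₁ ψ∈
  ... | no _   | yes ¬ψ∈ = inj₂ ¬ψ∈
  ... | no ψ∉  | no ¬ψ∉  = ⊥-elim (limit-consistent
        (⊢-taut₂ (∉limit-refutable ψ ψ∉) (∉limit-refutable (¬' ψ) ¬ψ∉) refute-both))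
    where
      refute-both : (ψ →' ⊥') & ((¬' ψ) →' ⊥') ⊨ₜ ⊥'
      refute-both v w ψ→⊥ ¬ψ→⊥ with tv v w ψ
      ... | true  = ⇒ᵇ-elim _ (tv v w ⊥') ψ→⊥ refl
      ... | false = ⇒ᵇ-elim _ (tv v w ⊥') ¬ψ→⊥ refl

  extension : MCS
  extension = record
    { holds      = λ φ → does (em (limit φ))
    ; consistent = limit-consistent ∘ ⊢-mono (does⇒ (em _))
    ; maximal    = λ φ → Data.Sum.map (dec-true (em _)) (dec-true (em _)) (limit-maximal φ)
    }

  Γ⊆extension : ∀ φ → Γ φ → φ ∈ extension
  Γ⊆extension φ γ = dec-true (em (limit φ)) (0 , γ)

lindenbaum : ExcludedMiddle → ∀ {Γ} → Consistent Γ → ∃ λ s → ∀ φ → Γ φ → φ ∈ s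
lindenbaum em Γ-consistent = extension , Γ⊆extension
  where open Lindenbaum em Γ-consistent

mcs-complete : ExcludedMiddle → ∀ {Γ φ} → (∀ s → (∀ γ → Γ γ → γ ∈ s) → φ ∈ s) → Γ ⊢ φ
mcs-complete em {Γ} {φ} valid with em (Γ ⊢ φ)
... | yes Γ⊢φ = Γ⊢φ
... | no  Γ⊬φ =
  let (s , Γ¬φ⊆s) = lindenbaum em (consistent-∪-¬ Γ⊬φ)
  in ⊥-elim (¬-∈ s (Γ¬φ⊆s (¬' φ) (inj₂ refl)) (valid s λ γ γ∈Γ → Γ¬φ⊆s γ (inj₁ γ∈Γ)))

⊆⇒Thm→ : ExcludedMiddle → ∀ {φ ψ} → (∀ s → φ ∈ s → ψ ∈ s) → Thm (φ →' ψ)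
⊆⇒Thm→ em {φ} φ⊆ψ = ⊢-∅ (deduction (⊢-mono inj₂ (mcs-complete em {｛ φ ｝} λ s φ⊆s → φ⊆ψ s (φ⊆s φ refl))))

holds-¬ : ∀ s φ → holds s (¬' φ) ≡ not (holds s φ)
holds-¬ s φ = ⇔→≡ (mk⇔ (λ ¬φ∈s → not-intro _ (¬-∈ s ¬φ∈s)) (λ φ∉s → ∉-¬ s (not-elim _ φ∉s)))

holds-∧ : ∀ s φ ψ → holds s (φ ∧' ψ) ≡ holds s φ ∧ holds s ψ
holds-∧ s φ ψ = ⇔→≡ (mk⇔
  (λ φψ∈s → ∧-intro (∈-taut₂ s φψ∈s φψ∈s λ v w t _ → ∧-conicalˡ (tv v w φ) _ t)
                    (∈-taut₂ s φψ∈s φψ∈s λ v w t _ → ∧-conicalʳ (tv v w φ) _ t))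
  (λ t → ∈-taut₂ s (∧-conicalˡ _ _ t) (∧-conicalʳ _ _ t) λ v w → ∧-intro))

↔-taut-→ : ∀ {φ ψ} → (φ ↔' ψ) ⊨ₜ (φ →' ψ)
↔-taut-→ v w = ∧-conicalˡ _ _

↔-taut-← : ∀ {φ ψ} → (φ ↔' ψ) ⊨ₜ (ψ →' φ)
↔-taut-← v w = ∧-conicalʳ _ _

∨-absorb-taut : ∀ {φ ψ} → (φ →' ψ) ⊨ₜ ((φ ∨' ψ) ↔' ψ)
∨-absorb-taut {φ} {ψ} v w φ→ψ = ⇔ᵇ-intro (∨ᵇ-absorb (tv v w φ) (tv v w ψ) φ→ψ)
  where
    ∨ᵇ-absorb : ∀ a b → IsTrue (a ⇒ᵇ b) → a ∨ᵇ b ≡ b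
    ∨ᵇ-absorb true  true _ = refl
    ∨ᵇ-absorb false b    _ = not-involutive b

Δ-absorb : ∀ s {φ ψ} → Thm (φ →' ψ) → Δ (φ ∨' ψ) ∈ s → Δ ψ ∈ s
Δ-absorb s {φ} {ψ} ⊢φ→ψ =
  Thm-mp s (Thm-taut (REΔ (Thm-taut ⊢φ→ψ (∨-absorb-taut {φ} {ψ}))) (↔-taut-→ {Δ (φ ∨' ψ)} {Δ ψ}))

Supports : MCS → Form → Set
Supports s φ = ∀ ψ → Thm (φ →' ψ) → Δ ψ ∈ s

Supports⇒Δ : ∀ s {φ} → Supports s φ → Δ φ ∈ s
Supports⇒Δ s {φ} sup = sup φ (taut λ v w → ⇒ᵇ-intro (tv v w φ) _ λ p → p)

module Canonical (em : ExcludedMiddle) where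

  unsupported : ∀ s φ → ¬ Supports s φ → ∃ λ ψ → Thm (φ →' ψ) × Δ ψ ∉ s
  unsupported s φ ¬sup with em (∃ λ ψ → Thm (φ →' ψ) × Δ ψ ∉ s)
  ... | yes counterexample = counterexample
  ... | no  none = ⊥-elim (¬sup λ ψ ⊢φ→ψ → IsTrue-stable _ λ Δψ∉s → none (ψ , ⊢φ→ψ , Δψ∉s))

  Δ-dichotomy : ∀ s {ψ} → Δ ψ ∈ s → Supports s ψ ⊎ Supports s (¬' ψ)
  Δ-dichotomy s {ψ} Δψ∈s with em (Supports s ψ) | em (Supports s (¬' ψ))
  ... | yes sup | _         = inj₁ sup
  ... | no  _   | yes sup¬  = inj₂ sup¬
  ... | no ¬sup | no ¬sup¬ with unsupported s ψ ¬sup | unsupported s (¬' ψ) ¬sup¬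
  ...   | (χ , ⊢ψ→χ , Δχ∉s) | (χ′ , ⊢¬ψ→χ′ , Δχ′∉s)
    with ∨'-∈ s (Thm-mp s (ΔM ψ χ χ′) Δψ∈s)
  ...   | inj₁ Δψ∨χ∈s  = ⊥-elim (Δχ∉s (Δ-absorb s ⊢ψ→χ Δψ∨χ∈s))
  ...   | inj₂ Δ¬ψ∨χ′∈s = ⊥-elim (Δχ′∉s (Δ-absorb s ⊢¬ψ→χ′ Δ¬ψ∨χ′∈s))

  Supports-⊆ : ∀ s {φ ψ} → Supports s φ → (∀ t → φ ∈ t → ψ ∈ t) → Δ ψ ∈ s
  Supports-⊆ s {ψ = ψ} sup φ⊆ψ = sup ψ (⊆⇒Thm→ em φ⊆ψ)

  -- The supplementation of the minimal canonical neighbourhoods, so that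
  -- property (s) holds by construction.
  Neighbourhood : MCS → (MCS → Bool) → Set
  Neighbourhood s X = ∃ λ φ → (∀ t → φ ∈ t → IsTrue (X t)) × Supports s φ

  canonicalFrame : Frame
  canonicalFrame = record { S = MCS ; N = λ s X → does (em (Neighbourhood s X)) }

  canonicalModel : Model
  canonicalModel = record { frame = canonicalFrame ; V = λ p s → holds s (var p) }

  open Frame canonicalFrame using (N)

  N-intro : ∀ s {X} φ → (∀ t → φ ∈ t → IsTrue (X t)) → Supports s φ → IsTrue (N s X)
  N-intro s φ φ⊆X sup = dec-true (em _) (φ , φ⊆X , sup)

  N-elim : ∀ s {X} → IsTrue (N s X) → Neighbourhood s X
  N-elim s = does⇒ (em _)

  canonical-inClass : InClass canonicalFrame
  canonical-inClass = has-n , has-s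
    where
      Supports-⊤ : ∀ s → Supports s ⊤'
      Supports-⊤ s ψ ⊢⊤→ψ =
        Thm-mp s (Thm-taut (REΔ (Thm-taut ⊢⊤→ψ ⊤-equivalence)) (↔-taut-→ {Δ ⊤'} {Δ ψ})) (Thm⇒∈ s ΔN)
        where
          ⊤-equivalence : (⊤' →' ψ) ⊨ₜ (⊤' ↔' ψ)
          ⊤-equivalence v w ⊤→ψ =
            ∧-intro ⊤→ψ (⇒ᵇ-intro (tv v w ψ) (tv v w ⊤') λ _ → ⊤'-true v w)
      has-n : HasN canonicalFrame
      has-n s = N-intro s ⊤' (λ _ _ → refl) (Supports-⊤ s)
      has-s : HasS canonicalFrame
      has-s s X Y X∈N X⊆Y =
        let (φ , φ⊆X , sup) = N-elim s X∈N in N-intro s φ (λ t φ∈t → X⊆Y t (φ⊆X t φ∈t)) sup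

  truth-Δ : ∀ {ψ} → (∀ t → sat canonicalModel ψ t ≡ holds t ψ) →
            ∀ s → sat canonicalModel (Δ ψ) s ≡ holds s (Δ ψ)
  truth-Δ {ψ} ih s = ⇔→≡ (mk⇔ sat⇒∈ ∈⇒sat)
    where
      sat⇒∈ : IsTrue (sat canonicalModel (Δ ψ) s) → Δ ψ ∈ s
      sat⇒∈ satΔψ with ∨-elim _ _ satΔψ
      ... | inj₁ ψ∈N =
        let (φ , φ⊆ψ , sup) = N-elim s ψ∈N
        in Supports-⊆ s sup λ t φ∈t → trans (sym (ih t)) (φ⊆ψ t φ∈t)
      ... | inj₂ ¬ψ∈N =
        let (φ , φ⊆¬ψ , sup) = N-elim s ¬ψ∈N
            Δ¬ψ∈s = Supports-⊆ s sup λ t φ∈t →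
                      ∉-¬ t λ ψ∈t → not-elim _ (φ⊆¬ψ t φ∈t) (trans (ih t) ψ∈t)
        in Thm-mp s (Thm-taut (ΔEqu ψ) (↔-taut-← {Δ ψ} {Δ (¬' ψ)})) Δ¬ψ∈s
      ∈⇒sat : Δ ψ ∈ s → IsTrue (sat canonicalModel (Δ ψ) s)
      ∈⇒sat Δψ∈s with Δ-dichotomy s Δψ∈s
      ... | inj₁ sup  = ∨-introˡ _ (N-intro s ψ (λ t ψ∈t → trans (ih t) ψ∈t) sup)
      ... | inj₂ sup¬ = ∨-introʳ _ (N-intro s (¬' ψ)
            (λ t ¬ψ∈t → not-intro _ λ satψ → ¬-∈ t ¬ψ∈t (trans (sym (ih t)) satψ)) sup¬)

  truth : ∀ φ s → sat canonicalModel φ s ≡ holds s φ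
  truth (var p)  s = refl
  truth (¬' φ)   s = trans (cong not (truth φ s)) (sym (holds-¬ s φ))
  truth (φ ∧' ψ) s = trans (cong₂ _∧_ (truth φ s) (truth ψ s)) (sym (holds-∧ s φ ψ))
  truth (Δ ψ)    s = truth-Δ (λ t → truth ψ t) s

  strongly-complete : StronglyComplete
  strongly-complete Γ φ Γ⊨φ = mcs-complete em λ s Γ⊆s →
    trans (sym (truth φ s))
      (Γ⊨φ canonicalModel canonical-inClass s λ γ γ∈Γ → trans (truth γ s) (Γ⊆s γ γ∈Γ))

N-cong : ∀ F → HasS F → ∀ s {X Y} → (∀ t → X t ≡ Y t) → Frame.N F s X ≡ Frame.N F s Y
N-cong F has-s s {X} {Y} X≗Y = ⇔→≡ (mk⇔
  (λ X∈N → has-s s X Y X∈N λ t → subst IsTrue (X≗Y t))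
  (λ Y∈N → has-s s Y X Y∈N λ t → subst IsTrue (sym (X≗Y t))))

sat-as-tv : ∀ M φ s → sat M φ s ≡ tv (λ p → Model.V M p s) (λ ψ → sat M (Δ ψ) s) φ
sat-as-tv M (var p)  s = refl
sat-as-tv M (¬' φ)   s = cong not (sat-as-tv M φ s)
sat-as-tv M (φ ∧' ψ) s = cong₂ _∧_ (sat-as-tv M φ s) (sat-as-tv M ψ s)
sat-as-tv M (Δ φ)    s = refl

sound : Sound
sound φ (taut tautology) M _ s = trans (sat-as-tv M φ s) (tautology _ _)
sound _ (ΔEqu φ) M (_ , has-s) s = ⇔ᵇ-intro (trans (∨-comm (N s X) (N s Xᶜ))
  (cong (N s Xᶜ ∨_) (N-cong frame has-s s λ t → sym (not-involutive (X t)))))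
  where
    open Model M
    X Xᶜ : S → Bool
    X  t = sat M φ t
    Xᶜ t = not (X t)
sound _ (ΔM φ ψ χ) M (_ , has-s) s = ⇒ᵇ-intro _ _ λ Δφ → case ∨-elim _ _ Δφ of λ where
    (inj₁ X∈N)  → ∨ᵇ-introˡ _ (∨-introˡ _ (has-s s _ _ X∈N λ t → ∨ᵇ-introˡ _))
    (inj₂ Xᶜ∈N) → ∨ᵇ-introʳ _ (∨-introˡ _ (has-s s _ _ Xᶜ∈N λ t → ∨ᵇ-introˡ _))
sound _ ΔN M (has-n , has-s) s =
  ∨-introˡ _ (has-s s _ _ (has-n s) λ t _ → ⇒ᵇ-intro (Model.V M 0 t) _ λ p → p)
sound ψ (mp ⊢φ→ψ ⊢φ) M cl s = ⇒ᵇ-elim _ _ (sound _ ⊢φ→ψ M cl s) (sound _ ⊢φ M cl s)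
sound _ (REΔ {φ} {ψ} ⊢φ↔ψ) M (has-n , has-s) s = ⇔ᵇ-intro
  (cong₂ _∨_ (N-cong frame has-s s φ≗ψ) (N-cong frame has-s s λ t → cong not (φ≗ψ t)))
  where
    open Model M
    φ≗ψ : ∀ t → sat M φ t ≡ sat M ψ t
    φ≗ψ t = ⇔ᵇ-elim _ _ (sound _ ⊢φ↔ψ M (has-n , has-s) t)

mainTheorem6 : Sound × (ExcludedMiddle → StronglyComplete)
mainTheorem6 = sound , Canonical.strongly-complete
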